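{- Let $L$ be a finite semidistrim lattice and $x\in L$. Then $\mathsf{Row}_L(x)$ is a maximal element of the set $\{z\in L:\mathsf{Pop}^\downarrow_L(x)=x\wedge z\}$, and $\mathsf{Row}_L^{ -1}(x)$ is a minimal element of the set $\{z\in L:\mathsf{Pop}^\uparrow_L(x)=x\vee z\}$.
   Context: All lattices are finite. For a lattice $L$, $\mathcal{J}_L$ (resp. $\mathcal{M}_L$) is the set of join-irreducible (resp. meet-irreducible) elements; for $j\in\mathcal{J}_L$, $j_*$ is the unique element covered by $j$, and for $m\in\mathcal{M}_L$, $m^*$ is the unique element covering $m$. Let $\mathcal{M}_L(j)=\max\{z\in L: j_*=j\wedge z\}$ and $\mathcal{J}_L(m)=\min\{z\in L: m^*=m\vee z\}$. A pairing on $L$ is a bijection $\kappa:\mathcal{J}_L\to\mathcal{M}_L$ with $\kappa(j)\in\mathcal{M}_L(j)$ for all $j$ and $\kappa^{ -1}(m)\in\mathcal{J}_L(m)$ for all $m$; $L$ is uniquely paired if it has exactly one pairing, denoted $\kappa_L$. A prime pair is a pair $(j_0,m_0)$ with $L=[\hat0,m_0]\sqcup[j_0,\hat1]$. A uniquely paired lattice $L$ is compatibly dismantlable if $|L|=1$ or there is a prime pair $(j_0,m_0)$ such that: (i) $[j_0,\hat1]$ is compatibly dismantlable and $\alpha(j)=j_0\vee j$ defines a bijection $\{j\in\mathcal{J}_L: j_0\le\kappa_L(j)\}\to\mathcal{J}_{[j_0,\hat1]}$ with $\kappa_{[j_0,\hat1]}(\alpha(j))=\kappa_L(j)$; (ii)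 $[\hat0,m_0]$ is compatibly dismantlable and $\beta(m)=m_0\wedge m$ defines a bijection $\{m\in\mathcal{M}_L:\kappa_L^{ -1}(m)\le m_0\}\to\mathcal{M}_{[\hat0,m_0]}$ with $\kappa_{[\hat0,m_0]}^{ -1}(\beta(m))=\kappa_L^{ -1}(m)$. The Galois graph $G_L$ is the directed graph on $\mathcal{J}_L$ with an edge $j\to j'$ iff $j\ne j'$ and $j\not\le\kappa_L(j')$. For $x\in L$ let $J_L(x)=\{j\in\mathcal{J}_L:j\le x\}$ and $M_L(x)=\{j\in\mathcal{J}_L:\kappa_L(j)\ge x\}$. For a compatibly dismantlable $L$, for every cover $x\lessdot y$ the set $M_L(x)\cap J_L(y)$ has exactly one element $j_{xy}$; set $\mathcal{D}_L(x)=\{j_{yx}:y\lessdot x\}$ and $\mathcal{U}_L(x)=\{j_{xy}:x\lessdot y\}$. $L$ is semidistrim if it is compatibly dismantlable and $\mathcal{D}_L(x)$, $\mathcal{U}_L(x)$ are independent sets (no two elements adjacent) of $G_L$ for all $x\in L$. For semidistrim $L$, the maps $\mathcal{D}_L$ and $\mathcal{U}_L$ are bijections from $L$ to the set of independent sets of $G_L$, and rowmotion $\mathsf{Row}_L:L\to L$ is the bijection defined by $\mathcal{U}_L(\mathsf{Row}_L(x))=\mathcal{D}_L(x)$. For any lattice, $\mathsf{Pop}^\downarrow_L(x)=x\wedge\bigwedge\{y:y\lessdot x\}$ and $\mathsf{Pop}^\uparrow_L(x)=x\vee\bigvee\{y:x\lessdot y\}$. -}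

module Defs where

open import Level using (0ℓ)
open import Data.Product using (Σ; Σ-syntax; _×_; _,_; proj₁; proj₂)
open import Data.Sum using (_⊎_; inj₁; inj₂)
open import Data.List using (List; foldr; filter)
open import Data.List.Membership.Propositional using (_∈_)
open import Data.List.Relation.Unary.All as All using (All; all?)
open import Relation.Nullary using (¬_; Dec; yes; no)
open import Relation.Nullary.Decidable using (_×-dec_; _⊎-dec_; _→-dec_; ¬?)
open import Relation.Binary using (Decidable)
open import Relation.Binary.PropositionalEquality using (_≡_; _≢_)
open import Relation.Binary.Lattice.Structures using (IsBoundedLattice)
open import Function.Bundles using (_⇔_)

record FinLattice : Set₁ where
  field
    Carrier          : Set
    _≤_              : Carrier → Carrier → Set
    _∨_              : Carrier → Carrier → Carrier
    _∧_              : Carrier → Carrier → Carrier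
    ⊤                : Carrier
    ⊥                : Carrier
    isBoundedLattice : IsBoundedLattice _≡_ _≤_ _∨_ _∧_ ⊤ ⊥
    elements         : List Carrier
    complete         : ∀ x → x ∈ elements
    _≟_              : Decidable (_≡_ {A = Carrier})
    _≤?_             : Decidable _≤_

  infix 4 _≤_
  infixr 6 _∨_
  infixr 7 _∧_

-- Theory of a finite lattice L.  Intervals [a,b] of L are handled
-- uniformly: all notions are defined relative to an interval [a,b]
-- (meets/joins/covers in [a,b] coincide with those of L).

module Theory (L : FinLattice) where
  open FinLattice L public
  A = Carrier

  _<_ : A → A → Set
  x < y = x ≤ y × x ≢ y

  _⋖_ : A → A → Set
  x ⋖ y = x < y × (∀ z → x ≤ z → z ≤ y → (z ≡ x ⊎ z ≡ y))

  private
    allBetween? : (x y : A) → Dec (All (λ z → x ≤ z → z ≤ y → (z ≡ x ⊎ z ≡ y)) elements)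
    allBetween? x y = all? (λ z → (x ≤? z) →-dec ((z ≤? y) →-dec ((z ≟ x) ⊎-dec (z ≟ y)))) elements

  _⋖?_ : Decidable _⋖_
  x ⋖? y with x ≤? y | x ≟ y | allBetween? x y
  ... | yes p | no q | yes r = yes ((p , q) , λ z → All.lookup r (complete z))
  ... | no p  | _    | _     = no (λ c → p (proj₁ (proj₁ c)))
  ... | yes _ | yes q | _    = no (λ c → proj₂ (proj₁ c) q)
  ... | yes _ | no _ | no r  = no (λ c → r (All.tabulate (λ {z} _ → proj₂ c z)))

  ⋀ : List A → A
  ⋀ = foldr _∧_ ⊤

  ⋁ : List A → A
  ⋁ = foldr _∨_ ⊥

  Pop↓ : A → A
  Pop↓ x = x ∧ ⋀ (filter (λ y → y ⋖? x) elements)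

  Pop↑ : A → A
  Pop↑ x = x ∨ ⋁ (filter (λ y → x ⋖? y) elements)

  IsMaximal : (A → Set) → A → Set
  IsMaximal P r = P r × (∀ w → P w → r ≤ w → w ≡ r)

  IsMinimal : (A → Set) → A → Set
  IsMinimal P r = P r × (∀ w → P w → w ≤ r → w ≡ r)

  In : A → A → A → Set
  In a b z = a ≤ z × z ≤ b

  LowerCover : A → A → A → A → Set
  LowerCover a b j s = In a b s × s ⋖ j × (∀ y → In a b y → y ⋖ j → y ≡ s)

  UpperCover : A → A → A → A → Set
  UpperCover a b m t = In a b t × m ⋖ t × (∀ y → In a b y → m ⋖ y → y ≡ t)

  JI : A → A → A → Set
  JI a b j = In a b j × Σ[ s ∈ A ] LowerCover a b j s

  MI : A → A → A → Set
  MI a b m = In a b m × Σ[ t ∈ A ] UpperCover a b m t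

  InMset : A → A → A → A → A → Set
  InMset a b j s z = IsMaximal (λ w → In a b w × s ≡ j ∧ w) z

  InJset : A → A → A → A → A → Set
  InJset a b m t z = IsMinimal (λ w → In a b w × t ≡ m ∨ w) z

  record Pairing (a b : A) : Set where
    field
      κ      : A → A
      κ⁻     : A → A
      κ-MI   : ∀ j → JI a b j → MI a b (κ j)
      κ⁻-JI  : ∀ m → MI a b m → JI a b (κ⁻ m)
      κ⁻κ    : ∀ j → JI a b j → κ⁻ (κ j) ≡ j
      κκ⁻    : ∀ m → MI a b m → κ (κ⁻ m) ≡ m
      κ-M    : ∀ j s → JI a b j → LowerCover a b j s → InMset a b j s (κ j)
      κ⁻-J   : ∀ m t → MI a b m → UpperCover a b m t → InJset a b m t (κ⁻ m)

  UniquelyPaired : A → A → Set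
  UniquelyPaired a b =
    Σ[ P ∈ Pairing a b ] (∀ (P' : Pairing a b) → ∀ j → JI a b j → Pairing.κ P' j ≡ Pairing.κ P j)

  κof : ∀ {a b} → UniquelyPaired a b → A → A
  κof up = Pairing.κ (proj₁ up)

  κ⁻of : ∀ {a b} → UniquelyPaired a b → A → A
  κ⁻of up = Pairing.κ⁻ (proj₁ up)

  PrimePair : A → A → A → A → Set
  PrimePair a b j0 m0 =
    In a b j0 × In a b m0 ×
    (∀ z → In a b z → (z ≤ m0 ⊎ j0 ≤ z) × ¬ (z ≤ m0 × j0 ≤ z))

  Condα : ∀ {a b j0} → UniquelyPaired a b → UniquelyPaired j0 b → Set
  Condα {a} {b} {j0} up upU =
    (∀ j → JI a b j → j0 ≤ κ j → JI j0 b (j0 ∨ j) × κU (j0 ∨ j) ≡ κ j) ×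
    (∀ j j' → JI a b j → JI a b j' → j0 ≤ κ j → j0 ≤ κ j' → j0 ∨ j ≡ j0 ∨ j' → j ≡ j') ×
    (∀ i → JI j0 b i → Σ[ j ∈ A ] (JI a b j × j0 ≤ κ j × j0 ∨ j ≡ i))
    where
      κ = κof up
      κU = κof upU

  Condβ : ∀ {a b m0} → UniquelyPaired a b → UniquelyPaired a m0 → Set
  Condβ {a} {b} {m0} up upL =
    (∀ m → MI a b m → κ⁻ m ≤ m0 → MI a m0 (m0 ∧ m) × κ⁻L (m0 ∧ m) ≡ κ⁻ m) ×
    (∀ m m' → MI a b m → MI a b m' → κ⁻ m ≤ m0 → κ⁻ m' ≤ m0 → m0 ∧ m ≡ m0 ∧ m' → m ≡ m') ×
    (∀ i → MI a m0 i → Σ[ m ∈ A ] (MI a b m × κ⁻ m ≤ m0 × m0 ∧ m ≡ i))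
    where
      κ⁻ = κ⁻of up
      κ⁻L = κ⁻of upL

  data CompDism : (a b : A) → UniquelyPaired a b → Set where
    cd-one  : ∀ {a b up} → a ≡ b → CompDism a b up
    cd-step : ∀ {a b up} (j0 m0 : A) → PrimePair a b j0 m0 →
              (upU : UniquelyPaired j0 b) → CompDism j0 b upU →
              (upL : UniquelyPaired a m0) → CompDism a m0 upL →
              Condα up upU → Condβ up upL → CompDism a b up

  module WithPairing (up : UniquelyPaired ⊥ ⊤) where
    κL = κof up

    JL : A → Set
    JL = JI ⊥ ⊤

    Edge : A → A → Set
    Edge j j' = j ≢ j' × ¬ (j ≤ κL j')

    Independent : (A → Set) → Set
    Independent S = ∀ j j' → S j → S j' → ¬ Edge j j'

    -- j ∈ M_L(y) ∩ J_L(x)  (j_{yx} for a cover y ⋖ x)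
    -- D_L(x) = { j_{yx} : y ⋖ x }
    InD : A → A → Set
    InD x j = JL j × Σ[ y ∈ A ] (y ⋖ x × y ≤ κL j × j ≤ x)

    InU : A → A → Set
    InU x j = JL j × Σ[ y ∈ A ] (x ⋖ y × x ≤ κL j × j ≤ y)

    IsRow : A → A → Set
    IsRow x r = ∀ j → InU r j ⇔ InD x j

  Semidistrim : Set
  Semidistrim =
    Σ[ up ∈ UniquelyPaired ⊥ ⊤ ] (CompDism ⊥ ⊤ up ×
      (∀ x → Independent up (InD up x) × Independent up (InU up x)))
    where open WithPairing using (Independent; InD; InU)

module Submission where

-- Compatible dismantlability labels every cover x ⋖ y by a join-irreducible j with
-- j ≤ y and x ≤ κ j (induction along prime pairs), and no join-irreducible satisfies
-- j ≤ κ j.  Let U(r) = D(x).  Every w > r lies above some label j ∈ U(r) = D(x), so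
-- j ≤ x and Pop↓ x ≤ κ j, while r ≤ κ j; hence w can neither be r ∨ Pop↓ x nor satisfy
-- x ∧ w = Pop↓ x.  This gives Pop↓ x ≤ r and the maximality of r.  Conversely the label
-- j ∈ D(x) = U(r) of a lower cover y ⋖ x gives x ∧ r ≤ x ∧ κ j = y, so x ∧ r ≤ Pop↓ x.

open import Defs
open import Data.Product using (_×_; proj₁; proj₂; Σ-syntax; _,_)
open import Data.Sum using (_⊎_; inj₁; inj₂)
open import Data.Empty using (⊥-elim)
open import Data.List using ([]; _∷_)
open import Data.List.Relation.Unary.All as All using (All; []; _∷_)
open import Data.List.Relation.Unary.Any using (here; there)
open import Data.List.Membership.Propositional using (_∈_)
open import Data.List.Membership.Propositional.Properties using (∈-filter⁺; ∈-filter⁻)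
open import Function.Base using (flip)
open import Function.Bundles using (Equivalence)
open import Relation.Nullary using (¬_; Dec; yes; no)
open import Relation.Nullary.Decidable using (_×-dec_; ¬?)
open import Relation.Binary using (Decidable)
open import Relation.Binary.Structures using (IsPartialOrder)
open import Relation.Binary.Lattice.Structures using (module IsBoundedLattice)
import Relation.Binary.Construct.Flip.EqAndOrd as Flip
open import Relation.Binary.PropositionalEquality using (_≡_; refl; sym; trans; subst; cong)

module _ {A : Set} {_≼_ : A → A → Set} (≼-isPartialOrder : IsPartialOrder _≡_ _≼_)
         (_≼?_ : Decidable _≼_) {P : A → Set} (P? : ∀ z → Dec (P z)) where
  open IsPartialOrder ≼-isPartialOrder using (antisym) renaming (refl to ≼-refl; trans to ≼-trans)

  minimal-below : ∀ xs {c} → P c →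
    Σ[ m ∈ A ] (P m × m ≼ c × (∀ {z} → z ∈ xs → P z → z ≼ m → z ≡ m))
  minimal-below [] {c} Pc = c , Pc , ≼-refl , λ ()
  minimal-below (x ∷ xs) {c} Pc with P? x | x ≼? c
  ... | yes Px | yes x≼c with minimal-below xs Px
  ...   | m , Pm , m≼x , min = m , Pm , ≼-trans m≼x x≼c , λ
          { (here refl) _ x≼m → antisym x≼m m≼x
          ; (there z∈xs)      → min z∈xs }
  minimal-below (x ∷ xs) {c} Pc | yes _ | no x⋠c with minimal-below xs Pc
  ...   | m , Pm , m≼c , min = m , Pm , m≼c , λ
          { (here refl) _ x≼m → ⊥-elim (x⋠c (≼-trans x≼m m≼c))
          ; (there z∈xs)      → min z∈xs }
  minimal-below (x ∷ xs) {c} Pc | no ¬Px | _ with minimal-below xs Pc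
  ...   | m , Pm , m≼c , min = m , Pm , m≼c , λ
          { (here refl) Px _ → ⊥-elim (¬Px Px)
          ; (there z∈xs)     → min z∈xs }

module _ (L : FinLattice) where
  open Theory L
  open IsBoundedLattice isBoundedLattice
    using (isPartialOrder; antisym; x≤x∨y; y≤x∨y; ∨-least; x∧y≤x; x∧y≤y; ∧-greatest; maximum; minimum)
    renaming (refl to ≤-refl; trans to ≤-trans; reflexive to ≤-reflexive)

  ≤∧¬<⇒≡ : ∀ {x y} → x ≤ y → ¬ x < y → x ≡ y
  ≤∧¬<⇒≡ {x} {y} x≤y x≮y with x ≟ y
  ... | yes x≡y = x≡y
  ... | no  x≢y = ⊥-elim (x≮y (x≤y , x≢y))

  cover-above : ∀ {x w} → x < w → Σ[ z ∈ A ] (x ⋖ z × z ≤ w)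
  cover-above {x} {w} x<w with minimal-below isPartialOrder _≤?_ P? elements (x<w , ≤-refl)
    where
    P? : ∀ z → Dec (x < z × z ≤ w)
    P? z = ((x ≤? z) ×-dec ¬? (x ≟ z)) ×-dec (z ≤? w)
  ... | m , (x<m , m≤w) , _ , min = m , (x<m , between) , m≤w
    where
    between : ∀ z → x ≤ z → z ≤ m → z ≡ x ⊎ z ≡ m
    between z x≤z z≤m with x ≟ z
    ... | yes x≡z = inj₁ (sym x≡z)
    ... | no  x≢z = inj₂ (min (complete z) ((x≤z , x≢z) , ≤-trans z≤m m≤w) z≤m)

  cover-below : ∀ {w x} → w < x → Σ[ z ∈ A ] (z ⋖ x × w ≤ z)
  cover-below {w} {x} w<x
    with minimal-below (Flip.isPartialOrder isPartialOrder) (flip _≤?_) P? elements (≤-refl , w<x)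
    where
    P? : ∀ z → Dec (w ≤ z × z < x)
    P? z = (w ≤? z) ×-dec ((z ≤? x) ×-dec ¬? (z ≟ x))
  ... | m , (w≤m , m<x) , _ , max = m , (m<x , between) , w≤m
    where
    between : ∀ z → m ≤ z → z ≤ x → z ≡ m ⊎ z ≡ x
    between z m≤z z≤x with z ≟ x
    ... | yes z≡x = inj₂ z≡x
    ... | no  z≢x = inj₁ (max (complete z) (≤-trans w≤m m≤z , z≤x , z≢x) m≤z)

  ⋖-meet : ∀ {x y k} → y ⋖ x → y ≤ k → ¬ x ≤ k → x ∧ k ≡ y
  ⋖-meet {x} {y} {k} ((y≤x , _) , y⋖x) y≤k x≰k with y⋖x (x ∧ k) (∧-greatest y≤x y≤k) (x∧y≤x x k)
  ... | inj₁ x∧k≡y = x∧k≡y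
  ... | inj₂ x∧k≡x = ⊥-elim (x≰k (subst (_≤ k) x∧k≡x (x∧y≤y x k)))

  ⋖-join : ∀ {x y j} → x ⋖ y → j ≤ y → ¬ j ≤ x → x ∨ j ≡ y
  ⋖-join {x} {y} {j} ((x≤y , _) , x⋖y) j≤y j≰x with x⋖y (x ∨ j) (x≤x∨y x j) (∨-least x≤y j≤y)
  ... | inj₁ x∨j≡x = ⊥-elim (j≰x (subst (j ≤_) x∨j≡x (y≤x∨y x j)))
  ... | inj₂ x∨j≡y = x∨j≡y

  ⋀-lowerBound : ∀ {y ys} → y ∈ ys → ⋀ ys ≤ y
  ⋀-lowerBound (here refl)  = x∧y≤x _ _
  ⋀-lowerBound (there y∈ys) = ≤-trans (x∧y≤y _ _) (⋀-lowerBound y∈ys)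

  ⋀-greatest : ∀ {z ys} → All (z ≤_) ys → z ≤ ⋀ ys
  ⋀-greatest []           = maximum _
  ⋀-greatest (z≤y ∷ z≤ys) = ∧-greatest z≤y (⋀-greatest z≤ys)

  ⋁-upperBound : ∀ {y ys} → y ∈ ys → y ≤ ⋁ ys
  ⋁-upperBound (here refl)  = x≤x∨y _ _
  ⋁-upperBound (there y∈ys) = ≤-trans (⋁-upperBound y∈ys) (y≤x∨y _ _)

  ⋁-least : ∀ {z ys} → All (_≤ z) ys → ⋁ ys ≤ z
  ⋁-least []           = minimum _
  ⋁-least (y≤z ∷ ys≤z) = ∨-least y≤z (⋁-least ys≤z)

  Pop↓≤lowerCover : ∀ {x y} → y ⋖ x → Pop↓ x ≤ y
  Pop↓≤lowerCover {x} y⋖x = ≤-trans (x∧y≤y _ _) (⋀-lowerBound (∈-filter⁺ (_⋖? x) (complete _) y⋖x))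

  Pop↓-greatest : ∀ {x z} → z ≤ x → (∀ {y} → y ⋖ x → z ≤ y) → z ≤ Pop↓ x
  Pop↓-greatest {x} z≤x z≤lowerCovers =
    ∧-greatest z≤x (⋀-greatest (All.tabulate (λ y∈ → z≤lowerCovers (proj₂ (∈-filter⁻ (_⋖? x) {xs = elements} y∈)))))

  upperCover≤Pop↑ : ∀ {x y} → x ⋖ y → y ≤ Pop↑ x
  upperCover≤Pop↑ {x} x⋖y = ≤-trans (⋁-upperBound (∈-filter⁺ (x ⋖?_) (complete _) x⋖y)) (y≤x∨y _ _)

  Pop↑-least : ∀ {x z} → x ≤ z → (∀ {y} → x ⋖ y → y ≤ z) → Pop↑ x ≤ z
  Pop↑-least {x} x≤z upperCovers≤z =
    ∨-least x≤z (⋁-least (All.tabulate (λ y∈ → upperCovers≤z (proj₂ (∈-filter⁻ (x ⋖?_) {xs = elements} y∈)))))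

  JI⇒≰κ : ∀ {a b j} (P : Pairing a b) → JI a b j → ¬ j ≤ Pairing.κ P j
  JI⇒≰κ P ji@(_ , s , lc@(_ , ((_ , s≢j) , _) , _)) j≤κj with Pairing.κ-M P _ s ji lc
  ... | (_ , s≡j∧κj) , _ = s≢j (trans s≡j∧κj (antisym (x∧y≤x _ _) (∧-greatest ≤-refl j≤κj)))

  module PrimePairProperties {a b j0 m0} (pp : PrimePair a b j0 m0) where
    In-j0 : In a b j0
    In-j0 = proj₁ pp

    In-m0 : In a b m0
    In-m0 = proj₁ (proj₂ pp)

    split : ∀ z → In a b z → (z ≤ m0 ⊎ j0 ≤ z) × ¬ (z ≤ m0 × j0 ≤ z)
    split = proj₂ (proj₂ pp)

    j0≰m0 : ¬ j0 ≤ m0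
    j0≰m0 j0≤m0 = proj₂ (split j0 In-j0) (j0≤m0 , ≤-refl)

    below-j0⇒≤m0 : ∀ {z} → In a b z → z < j0 → z ≤ m0
    below-j0⇒≤m0 {z} In-z (z≤j0 , z≢j0) with proj₁ (split z In-z)
    ... | inj₁ z≤m0 = z≤m0
    ... | inj₂ j0≤z = ⊥-elim (z≢j0 (antisym z≤j0 j0≤z))

    -- Both lower covers of j0 lie in [a, m0], so their join is below m0 and cannot be j0.
    j0-lowerCover : Σ[ s ∈ A ] LowerCover a b j0 s
    j0-lowerCover with cover-below {a} {j0} (proj₁ In-j0 , a≢j0)
      where
      a≢j0 : ¬ a ≡ j0
      a≢j0 refl = j0≰m0 (proj₁ In-m0)
    ... | s , s⋖j0@((s≤j0 , s≢j0) , s-cover) , a≤s = s , In-s , s⋖j0 , unique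
      where
      In-s = a≤s , ≤-trans s≤j0 (proj₂ In-j0)
      unique : ∀ y → In a b y → y ⋖ j0 → y ≡ s
      unique y In-y y⋖j0@((y≤j0 , _) , y-cover) with s-cover (s ∨ y) (x≤x∨y s y) (∨-least s≤j0 y≤j0)
      ... | inj₂ s∨y≡j0 = ⊥-elim (j0≰m0 (subst (_≤ m0) s∨y≡j0
                            (∨-least (below-j0⇒≤m0 In-s (s≤j0 , s≢j0)) (below-j0⇒≤m0 In-y (proj₁ y⋖j0)))))
      ... | inj₁ s∨y≡s with y-cover s (subst (y ≤_) s∨y≡s (y≤x∨y s y)) s≤j0
      ...   | inj₁ s≡y = sym s≡y
      ...   | inj₂ s≡j0 = ⊥-elim (s≢j0 s≡j0)

    j0-JI : JI a b j0
    j0-JI = In-j0 , j0-lowerCover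

    κ-j0 : (P : Pairing a b) → Pairing.κ P j0 ≡ m0
    κ-j0 P with j0-lowerCover
    ... | s , lc@(In-s , s⋖j0 , _) with Pairing.κ-M P j0 s j0-JI lc
    ...   | (In-κj0 , _) , maximal = sym (maximal m0 (In-m0 , s≡j0∧m0) κj0≤m0)
      where
      s≡j0∧m0 : s ≡ j0 ∧ m0
      s≡j0∧m0 = sym (⋖-meet s⋖j0 (below-j0⇒≤m0 In-s (proj₁ s⋖j0)) j0≰m0)
      κj0≤m0 : Pairing.κ P j0 ≤ m0
      κj0≤m0 with proj₁ (split _ In-κj0)
      ... | inj₁ κj0≤m0 = κj0≤m0
      ... | inj₂ j0≤κj0 = ⊥-elim (JI⇒≰κ P j0-JI j0≤κj0)

  Label : ∀ {a b} → UniquelyPaired a b → A → A → A → Set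
  Label {a} {b} up x y j = JI a b j × j ≤ y × x ≤ κof up j

  Condα-label : ∀ {a b j0} {up : UniquelyPaired a b} {upU : UniquelyPaired j0 b} →
    Condα up upU → ∀ {x y} → Σ[ i ∈ A ] Label upU x y i → Σ[ j ∈ A ] Label up x y j
  Condα-label {j0 = j0} (α-sound , _ , α-onto) {x} (_ , ji , i≤y , x≤κi) with α-onto _ ji
  ... | j , jj , j0≤κj , refl =
    j , jj , ≤-trans (y≤x∨y j0 j) i≤y , subst (x ≤_) (proj₂ (α-sound j jj j0≤κj)) x≤κi

  Condβ-label : ∀ {a b m0} {up : UniquelyPaired a b} {upL : UniquelyPaired a m0} →
    Condβ up upL → ∀ {x y} → Σ[ i ∈ A ] Label upL x y i → Σ[ j ∈ A ] Label up x y j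
  Condβ-label {m0 = m0} {up} {upL} (β-sound , _ , β-onto) {x} {y} (i , ji , i≤y , x≤κi)
    with β-onto (κof upL i) (Pairing.κ-MI (proj₁ upL) i ji)
  ... | m , mm , κ⁻m≤m0 , m0∧m≡κi = κ⁻of up m , Pairing.κ⁻-JI (proj₁ up) m mm ,
                                      subst (_≤ y) (sym κ⁻m≡i) i≤y , x≤κκ⁻m
    where
    κ⁻m≡i : κ⁻of up m ≡ i
    κ⁻m≡i = trans (sym (proj₂ (β-sound m mm κ⁻m≤m0)))
                  (trans (cong (κ⁻of upL) m0∧m≡κi) (Pairing.κ⁻κ (proj₁ upL) i ji))
    x≤κκ⁻m : x ≤ κof up (κ⁻of up m)
    x≤κκ⁻m = subst (x ≤_) (sym (Pairing.κκ⁻ (proj₁ up) m mm))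
                   (≤-trans x≤κi (subst (_≤ m) m0∧m≡κi (x∧y≤y m0 m)))

  -- A cover crossing the prime pair, from [a, m0] into [j0, b], is labelled by j0.
  cover-label : ∀ {a b up} → CompDism a b up →
    ∀ {x y} → In a b x → In a b y → x ⋖ y → Σ[ j ∈ A ] Label up x y j
  cover-label (cd-one refl) (a≤x , x≤a) (_ , y≤a) ((x≤y , x≢y) , _) =
    ⊥-elim (x≢y (antisym x≤y (≤-trans y≤a a≤x)))
  cover-label {up = up} (cd-step j0 m0 pp upU cdU upL cdL α β) {x} {y} (a≤x , x≤b) (a≤y , y≤b) x⋖y
    with proj₁ (proj₂ (proj₂ pp) x (a≤x , x≤b)) | proj₁ (proj₂ (proj₂ pp) y (a≤y , y≤b))
  ... | inj₂ j0≤x | _ =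
    Condα-label {up = up} {upU} α (cover-label cdU (j0≤x , x≤b) (≤-trans j0≤x (proj₁ (proj₁ x⋖y)) , y≤b) x⋖y)
  ... | inj₁ x≤m0 | inj₂ j0≤y =
    j0 , j0-JI , j0≤y , subst (x ≤_) (sym (κ-j0 (proj₁ up))) x≤m0
    where open PrimePairProperties pp
  ... | inj₁ x≤m0 | inj₁ y≤m0 =
    Condβ-label {up = up} {upL} β (cover-label cdL (a≤x , x≤m0) (a≤y , y≤m0) x⋖y)

  module _ {up : UniquelyPaired ⊥ ⊤} (cd : CompDism ⊥ ⊤ up) where
    open WithPairing up

    JL⇒≰κ : ∀ {j} → JL j → ¬ j ≤ κL j
    JL⇒≰κ = JI⇒≰κ (proj₁ up)

    InU-of-cover : ∀ {x y} → x ⋖ y → Σ[ j ∈ A ] (InU x j × j ≤ y)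
    InU-of-cover {x} {y} x⋖y with cover-label cd (minimum x , maximum x) (minimum y , maximum y) x⋖y
    ... | j , jl , j≤y , x≤κj = j , (jl , y , x⋖y , x≤κj , j≤y) , j≤y

    InD-of-cover : ∀ {x y} → x ⋖ y → Σ[ j ∈ A ] (InD y j × x ≤ κL j)
    InD-of-cover {x} {y} x⋖y with cover-label cd (minimum x , maximum x) (minimum y , maximum y) x⋖y
    ... | j , jl , j≤y , x≤κj = j , (jl , x , x⋖y , x≤κj , j≤y) , x≤κj

    InU-below : ∀ {r w} → r < w → Σ[ j ∈ A ] (InU r j × j ≤ w)
    InU-below r<w with cover-above r<w
    ... | z , r⋖z , z≤w with InU-of-cover r⋖z
    ...   | j , jU , j≤z = j , jU , ≤-trans j≤z z≤w

    InD-above : ∀ {w r} → w < r → Σ[ j ∈ A ] (InD r j × w ≤ κL j)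
    InD-above w<r with cover-below w<r
    ... | z , z⋖r , w≤z with InD-of-cover z⋖r
    ...   | j , jD , z≤κj = j , jD , ≤-trans w≤z z≤κj

    InD⇒Pop↓≤κ : ∀ {x j} → InD x j → Pop↓ x ≤ κL j
    InD⇒Pop↓≤κ (_ , y , y⋖x , y≤κj , _) = ≤-trans (Pop↓≤lowerCover y⋖x) y≤κj

    InU⇒≤Pop↑ : ∀ {x j} → InU x j → j ≤ Pop↑ x
    InU⇒≤Pop↑ (_ , y , x⋖y , _ , j≤y) = ≤-trans j≤y (upperCover≤Pop↑ x⋖y)

    module _ {x r} (row : IsRow x r) where
      private
        InU⇒InD : ∀ {j} → InU r j → InD x j
        InU⇒InD = Equivalence.to (row _)

        InD⇒InU : ∀ {j} → InD x j → InU r j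
        InD⇒InU = Equivalence.from (row _)

      row-above-gap : ∀ {w} → r < w → ¬ x ∧ w ≤ r ∨ Pop↓ x
      row-above-gap r<w x∧w≤ with InU-below r<w
      ... | j , jU@(jl , _ , _ , r≤κj , _) , j≤w with InU⇒InD jU
      ...   | jD@(_ , _ , _ , _ , j≤x) =
        JL⇒≰κ jl (≤-trans (∧-greatest j≤x j≤w) (≤-trans x∧w≤ (∨-least r≤κj (InD⇒Pop↓≤κ jD))))

      row-below-lowerCover : ∀ {y} → y ⋖ x → x ∧ r ≤ y
      row-below-lowerCover y⋖x with InD-of-cover y⋖x
      ... | j , jD@(jl , _ , _ , _ , j≤x) , y≤κj with InD⇒InU jD
      ...   | _ , _ , _ , r≤κj , _ =
        subst (x ∧ r ≤_) (⋖-meet y⋖x y≤κj (λ x≤κj → JL⇒≰κ jl (≤-trans j≤x x≤κj)))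
              (∧-greatest (x∧y≤x x r) (≤-trans (x∧y≤y x r) r≤κj))

    module _ {r x} (row : IsRow r x) where
      private
        InU⇒InD : ∀ {j} → InU x j → InD r j
        InU⇒InD = Equivalence.to (row _)

        InD⇒InU : ∀ {j} → InD r j → InU x j
        InD⇒InU = Equivalence.from (row _)

      row-below-gap : ∀ {w} → w < r → ¬ r ∧ Pop↑ x ≤ x ∨ w
      row-below-gap w<r ≤x∨w with InD-above w<r
      ... | j , jD@(jl , _ , _ , _ , j≤r) , w≤κj with InD⇒InU jD
      ...   | jU@(_ , _ , _ , x≤κj , _) =
        JL⇒≰κ jl (≤-trans (∧-greatest j≤r (InU⇒≤Pop↑ jU)) (≤-trans ≤x∨w (∨-least x≤κj w≤κj)))

      row-above-upperCover : ∀ {y} → x ⋖ y → y ≤ x ∨ r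
      row-above-upperCover x⋖y with InU-of-cover x⋖y
      ... | j , jU@(jl , _ , _ , x≤κj , _) , j≤y with InU⇒InD jU
      ...   | _ , _ , _ , _ , j≤r =
        subst (_≤ x ∨ r) (⋖-join x⋖y j≤y (λ j≤x → JL⇒≰κ jl (≤-trans j≤x x≤κj)))
              (∨-least (x≤x∨y x r) (≤-trans j≤r (y≤x∨y x r)))

    row-maximal : ∀ {x r} → IsRow x r → IsMaximal (λ z → Pop↓ x ≡ x ∧ z) r
    row-maximal {x} {r} row = antisym (∧-greatest (x∧y≤x _ _) Pop↓≤r) x∧r≤Pop↓ , maximal
      where
      r≡r∨Pop↓ : r ≡ r ∨ Pop↓ x
      r≡r∨Pop↓ = ≤∧¬<⇒≡ (x≤x∨y r _) (λ r< → row-above-gap row r< (x∧y≤y x _))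
      Pop↓≤r : Pop↓ x ≤ r
      Pop↓≤r = subst (Pop↓ x ≤_) (sym r≡r∨Pop↓) (y≤x∨y r _)
      x∧r≤Pop↓ : x ∧ r ≤ Pop↓ x
      x∧r≤Pop↓ = Pop↓-greatest (x∧y≤x x r) (row-below-lowerCover row)
      maximal : ∀ w → Pop↓ x ≡ x ∧ w → r ≤ w → w ≡ r
      maximal w Pop↓≡x∧w r≤w = sym (≤∧¬<⇒≡ r≤w (λ r<w →
        row-above-gap row r<w (≤-trans (≤-reflexive (sym Pop↓≡x∧w)) (y≤x∨y r _))))

    row⁻¹-minimal : ∀ {x r} → IsRow r x → IsMinimal (λ z → Pop↑ x ≡ x ∨ z) r
    row⁻¹-minimal {x} {r} row = antisym Pop↑≤x∨r (∨-least (x≤x∨y _ _) r≤Pop↑) , minimal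
      where
      r∧Pop↑≡r : r ∧ Pop↑ x ≡ r
      r∧Pop↑≡r = ≤∧¬<⇒≡ (x∧y≤x r _) (λ <r → row-below-gap row <r (y≤x∨y x _))
      r≤Pop↑ : r ≤ Pop↑ x
      r≤Pop↑ = subst (_≤ Pop↑ x) r∧Pop↑≡r (x∧y≤y r _)
      Pop↑≤x∨r : Pop↑ x ≤ x ∨ r
      Pop↑≤x∨r = Pop↑-least (x≤x∨y x r) (row-above-upperCover row)
      minimal : ∀ w → Pop↑ x ≡ x ∨ w → w ≤ r → w ≡ r
      minimal w Pop↑≡x∨w w≤r = ≤∧¬<⇒≡ w≤r (λ w<r →
        row-below-gap row w<r (≤-trans (x∧y≤y r _) (≤-reflexive Pop↑≡x∨w)))

theorem9p3 : (L : FinLattice) → (sd : Theory.Semidistrim L) →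
    let open Theory L
        open WithPairing (proj₁ sd)
    in ∀ x →
      (∀ r → IsRow x r → IsMaximal (λ z → Pop↓ x ≡ x ∧ z) r) ×
      (∀ r → IsRow r x → IsMinimal (λ z → Pop↑ x ≡ x ∨ z) r)
theorem9p3 L (_ , cd , _) x = (λ r → row-maximal L cd) , (λ r → row⁻¹-minimal L cd)
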